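{- If $D$ is a digraph of order $n$, then $dib(D)+dib(D^c)\leq n+1$.
   Context: All digraphs are finite, loopless, and simple: $D=(V,A)$ where $A$ is a set of ordered pairs $uv$ (darts) of distinct vertices; both $uv$ and $vu$ may be darts. The complement $D^c$ has vertex set $V(D)$, and for distinct $u,v$, $uv$ is a dart of $D^c$ if and only if $uv$ is not a dart of $D$. A coloring of $D$ with $k$ colors is a surjective map $\varsigma:V\to\{1,\dots,k\}$; it is acyclic if each color class induces a subdigraph with no directed cycle. With respect to $\varsigma$, a vertex $u$ is a $b^+$-vertex if for every color $j\neq\varsigma(u)$ there is a dart $uw$ with $\varsigma(w)=j$, and a $b^-$-vertex if for every color $j\neq \varsigma(u)$ there is a dart $wu$ with $\varsigma(w)=j$. A $b$-coloring is a coloring in which every color class contains a $b^+$-vertex and a $b^-$-vertex. The dib-chromatic number $dib(D)$ is the largest $k$ such that $D$ admits an acyclic $b$-coloring with $k$ colors. -}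

module Defs where

open import Data.Nat using (ℕ; zero; suc; _+_; _≤_)
open import Data.Fin using (Fin; zero; suc; inject₁; fromℕ; _≟_)
open import Data.Bool using (Bool; true; false; not; if_then_else_)
open import Data.Product using (Σ; ∃; _×_; _,_)
open import Relation.Nullary using (¬_)
open import Relation.Nullary.Decidable using (⌊_⌋)
open import Relation.Binary.PropositionalEquality using (_≡_; _≢_)

record Digraph (n : ℕ) : Set where
  field
    dart     : Fin n → Fin n → Bool
    loopless : ∀ v → dart v v ≡ false
open Digraph public

Dart : ∀ {n} → Digraph n → Fin n → Fin n → Set
Dart D u v = dart D u v ≡ true

complement : ∀ {n} → Digraph n → Digraph n
complement {n} D = record { dart = d ; loopless = ll }
  where
    d : Fin n → Fin n → Bool
    d u v = if ⌊ u ≟ v ⌋ then false else not (dart D u v)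
    ll : ∀ v → d v v ≡ false
    ll v with v ≟ v
    ... | Relation.Nullary.yes _ = Relation.Binary.PropositionalEquality.refl
    ... | Relation.Nullary.no ¬p = Data.Empty.⊥-elim (¬p Relation.Binary.PropositionalEquality.refl)
      where import Data.Empty

Coloring : ℕ → ℕ → Set
Coloring n k = Fin n → Fin k

Surjective : ∀ {n k} → Coloring n k → Set
Surjective {n} {k} ς = ∀ (j : Fin k) → ∃ λ (v : Fin n) → ς v ≡ j

-- A directed cycle of D with all vertices in color class c:
-- distinct vertices v_0, …, v_m (m ≥ 1, so length m+1 ≥ 2) with darts
-- v_i v_{i+1} and v_m v_0.
record MonoCycle {n k : ℕ} (D : Digraph n) (ς : Coloring n k) (c : Fin k) : Set where
  field
    m        : ℕ
    m≥1      : 1 ≤ m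
    vtx      : Fin (suc m) → Fin n
    distinct : ∀ i j → vtx i ≡ vtx j → i ≡ j
    step     : ∀ (i : Fin m) → Dart D (vtx (inject₁ i)) (vtx (suc i))
    close    : Dart D (vtx (fromℕ m)) (vtx zero)
    colored  : ∀ i → ς (vtx i) ≡ c

Acyclic : ∀ {n k} → Digraph n → Coloring n k → Set
Acyclic D ς = ∀ c → ¬ MonoCycle D ς c

IsBPlus : ∀ {n k} → Digraph n → Coloring n k → Fin n → Set
IsBPlus {n} {k} D ς u = ∀ (j : Fin k) → j ≢ ς u → ∃ λ (w : Fin n) → Dart D u w × ς w ≡ j

IsBMinus : ∀ {n k} → Digraph n → Coloring n k → Fin n → Set
IsBMinus {n} {k} D ς u = ∀ (j : Fin k) → j ≢ ς u → ∃ λ (w : Fin n) → Dart D w u × ς w ≡ j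

IsBColoring : ∀ {n k} → Digraph n → Coloring n k → Set
IsBColoring {n} {k} D ς =
  ∀ (c : Fin k) → (∃ λ u → ς u ≡ c × IsBPlus D ς u) × (∃ λ u → ς u ≡ c × IsBMinus D ς u)

HasAcyclicBColoring : ∀ {n} → Digraph n → ℕ → Set
HasAcyclicBColoring {n} D k =
  Σ (Coloring n k) λ ς → Surjective ς × Acyclic D ς × IsBColoring D ς

IsDib : ∀ {n} → Digraph n → ℕ → Set
IsDib D k = HasAcyclicBColoring D k × (∀ k' → HasAcyclicBColoring D k' → k' ≤ k)

{-# OPTIONS --safe #-}
-- Pick a b⁺-vertex in every colour class of an a-colouring of D and of a
-- b-colouring of Dᶜ. If these a + b vertices are distinct, then a + b ≤ n.
-- Otherwise some vertex v is a b⁺-vertex for both colourings: its closed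
-- out-neighbourhood in D meets all a colours, its out-neighbourhood in Dᶜ meets
-- the b − 1 colours other than its own, and these two vertex sets are disjoint,
-- so a + b − 1 ≤ n.
module Submission where

open import Defs
open import Data.Nat using (ℕ; suc; _+_; _≤_; s≤s)
open import Data.Nat.Properties using (≤-trans; m≤m+n; +-suc; +-comm; module ≤-Reasoning)
open import Data.Fin using (Fin; _≟_; splitAt; join; punchIn)
open import Data.Fin.Properties using (injective⇒≤; join-splitAt; any?; punchIn-injective; punchInᵢ≢i)
open import Data.Bool using (true; false)
open import Data.Sum using (_⊎_; inj₁; inj₂; [_,_])
open import Data.Product using (∃; _×_; _,_; proj₁; proj₂)
open import Data.Empty using (⊥)
open import Function using (_∘_; id)
open import Function.Definitions using (Injective)
open import Relation.Nullary using (yes; no)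
open import Relation.Binary.PropositionalEquality hiding ([_])

splitAt-injective : ∀ m {n} → Injective _≡_ _≡_ (splitAt m {n})
splitAt-injective m {n} {i} {j} eq = begin
  i                      ≡⟨ join-splitAt m n i ⟨
  join m n (splitAt m i) ≡⟨ cong (join m n) eq ⟩
  join m n (splitAt m j) ≡⟨ join-splitAt m n j ⟩
  j                      ∎
  where open ≡-Reasoning

⊎-injective⇒+≤ : ∀ {a b n} (f : Fin a ⊎ Fin b → Fin n) → Injective _≡_ _≡_ f → a + b ≤ n
⊎-injective⇒+≤ {a} f f-inj = injective⇒≤ {f = f ∘ splitAt a} (splitAt-injective a ∘ f-inj)

[,]-injective : ∀ {a b n} {f : Fin a → Fin n} {g : Fin b → Fin n} →
                Injective _≡_ _≡_ f → Injective _≡_ _≡_ g → (∀ x y → f x ≢ g y) →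
                Injective _≡_ _≡_ [ f , g ]
[,]-injective f-inj g-inj apart {inj₁ x} {inj₁ y} eq = cong inj₁ (f-inj eq)
[,]-injective f-inj g-inj apart {inj₁ x} {inj₂ y} eq with () ← apart x y eq
[,]-injective f-inj g-inj apart {inj₂ x} {inj₁ y} eq with () ← apart y x (sym eq)
[,]-injective f-inj g-inj apart {inj₂ x} {inj₂ y} eq = cong inj₂ (g-inj eq)

colour-injective : ∀ {n k m} (ς : Coloring n k) {r : Fin m → Fin n} {g : Fin m → Fin k} →
                   (∀ x → ς (r x) ≡ g x) → Injective _≡_ _≡_ g → Injective _≡_ _≡_ r
colour-injective ς {r} {g} ςr≡g g-inj {x} {y} rx≡ry = g-inj (begin
  g x     ≡⟨ ςr≡g x ⟨
  ς (r x) ≡⟨ cong ς rx≡ry ⟩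
  ς (r y) ≡⟨ ςr≡g y ⟩
  g y     ∎)
  where open ≡-Reasoning

DisjointDarts : ∀ {n} → Digraph n → Digraph n → Set
DisjointDarts D E = ∀ {u w} → Dart D u w → Dart E u w → ⊥

complement-disjoint : ∀ {n} (D : Digraph n) → DisjointDarts D (complement D)
complement-disjoint D {u} {w} _ _ with u ≟ w | dart D u w
complement-disjoint D _  () | yes _ | _
complement-disjoint D () _  | no _  | false
complement-disjoint D _  () | no _  | true

¬loop : ∀ {n} (D : Digraph n) {v} → Dart D v v → ⊥
¬loop D {v} vv with () ← trans (sym (loopless D v)) vv

closed-open-apart : ∀ {n} {D E : Digraph n} {v w w′} → DisjointDarts D E →
                    w ≡ v ⊎ Dart D v w → Dart E v w′ → w ≢ w′
closed-open-apart {E = E} _        (inj₁ refl) vw′ refl = ¬loop E vw′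
closed-open-apart         disjoint (inj₂ vw)   vw′ refl = disjoint vw vw′

bPlus-closedOutWitness : ∀ {n k} {D : Digraph n} {ς : Coloring n k} {v} → IsBPlus D ς v →
                         ∀ j → ∃ λ w → ς w ≡ j × (w ≡ v ⊎ Dart D v w)
bPlus-closedOutWitness {ς = ς} {v} v⁺ j with j ≟ ς v
... | yes refl = v , refl , inj₁ refl
... | no j≢ςv  = let w , vw , ςw≡j = v⁺ j j≢ςv in w , ςw≡j , inj₂ vw

commonBPlus⇒+≤ : ∀ {n a b} {D E : Digraph n} {ς : Coloring n a} {τ : Coloring n (suc b)} {v} →
                 DisjointDarts D E → IsBPlus D ς v → IsBPlus E τ v → a + b ≤ n
commonBPlus⇒+≤ {n} {a} {b} {D} {E} {ς} {τ} {v} disjoint v⁺D v⁺E =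
  ⊎-injective⇒+≤ [ inner , outer ] ([,]-injective inner-injective outer-injective apart)
  where
    inner-witness : ∀ j → ∃ λ w → ς w ≡ j × (w ≡ v ⊎ Dart D v w)
    inner-witness = bPlus-closedOutWitness {D = D} v⁺D

    outer-witness : ∀ k → ∃ λ w → Dart E v w × τ w ≡ punchIn (τ v) k
    outer-witness k = v⁺E (punchIn (τ v) k) (punchInᵢ≢i (τ v) k)

    inner : Fin a → Fin n
    inner = proj₁ ∘ inner-witness

    outer : Fin b → Fin n
    outer = proj₁ ∘ outer-witness

    inner-injective : Injective _≡_ _≡_ inner
    inner-injective = colour-injective ς (proj₁ ∘ proj₂ ∘ inner-witness) id

    outer-injective : Injective _≡_ _≡_ outer
    outer-injective =
      colour-injective τ (proj₂ ∘ proj₂ ∘ outer-witness) (punchIn-injective (τ v) _ _)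

    apart : ∀ j k → inner j ≢ outer k
    apart j k = closed-open-apart {D = D} {E} disjoint
                  (proj₂ (proj₂ (inner-witness j))) (proj₁ (proj₂ (outer-witness k)))

commonBPlus⇒≤ : ∀ {n a b} {D E : Digraph n} {ς : Coloring n a} {τ : Coloring n b} {v} →
                DisjointDarts D E → IsBPlus D ς v → IsBPlus E τ v → a + b ≤ n + 1
commonBPlus⇒≤ {b = 0} {τ = τ} {v} _ _ _ with () ← τ v
commonBPlus⇒≤ {n} {a} {suc b} {D} {E} disjoint v⁺D v⁺E = begin
  a + suc b   ≡⟨ +-suc a b ⟩
  suc (a + b) ≤⟨ s≤s (commonBPlus⇒+≤ {D = D} {E} disjoint v⁺D v⁺E) ⟩
  suc n       ≡⟨ +-comm 1 n ⟩
  n + 1       ∎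
  where open ≤-Reasoning

module _ {n k} (D : Digraph n) {ς : Coloring n k} (b-colouring : IsBColoring D ς) where

  bPlusVertex : Fin k → Fin n
  bPlusVertex c = proj₁ (proj₁ (b-colouring c))

  bPlusVertex-isBPlus : ∀ c → IsBPlus D ς (bPlusVertex c)
  bPlusVertex-isBPlus c = proj₂ (proj₂ (proj₁ (b-colouring c)))

  bPlusVertex-injective : Injective _≡_ _≡_ bPlusVertex
  bPlusVertex-injective = colour-injective ς (λ c → proj₁ (proj₂ (proj₁ (b-colouring c)))) id

theorem2 : ∀ (n : ℕ) (D : Digraph n) (a b : ℕ) →
    IsDib D a → IsDib (complement D) b → a + b ≤ n + 1
theorem2 n D a b ((ς , _ , _ , ς-b) , _) ((τ , _ , _ , τ-b) , _)
  with any? (λ x → any? (λ y → bPlusVertex D ς-b x ≟ bPlusVertex (complement D) τ-b y))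
... | yes (x , y , same) =
  commonBPlus⇒≤ {D = D} {complement D} (complement-disjoint D) (bPlusVertex-isBPlus D ς-b x)
    (subst (IsBPlus (complement D) τ) (sym same) (bPlusVertex-isBPlus (complement D) τ-b y))
... | no no-common = ≤-trans (⊎-injective⇒+≤ _ reps-injective) (m≤m+n n 1)
  where
    reps-injective : Injective _≡_ _≡_ [ bPlusVertex D ς-b , bPlusVertex (complement D) τ-b ]
    reps-injective = [,]-injective (bPlusVertex-injective D ς-b)
                                   (bPlusVertex-injective (complement D) τ-b)
                                   (λ x y same → no-common (x , y , same))
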